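{- If a logic $L$ has the uniform Lyndon interpolation property, then it has both the Lyndon interpolation property and the uniform interpolation property.
   Context: Formulas are built from atoms, $\bot$, $\wedge,\vee,\to$ and $\Box$; $\top$ abbreviates $\bot\to\bot$. A logic is a set $L$ of such formulas containing all intuitionistic propositional tautologies and closed under substitution and modus ponens; $L\vdash\phi$ means $\phi\in L$. Positive/negative variables: $V^+(p)=\{p\}$, $V^-(p)=\varnothing$ for atoms $p$; $V^{\pm}(\bot)=V^{\pm}(\top)=\varnothing$; $V^{\pm}(\phi\wedge\psi)=V^{\pm}(\phi\vee\psi)=V^{\pm}(\phi)\cup V^{\pm}(\psi)$; $V^+(\phi\to\psi)=V^-(\phi)\cup V^+(\psi)$, $V^-(\phi\to\psi)=V^+(\phi)\cup V^-(\psi)$; $V^{\pm}(\Box\phi)=V^{\pm}(\phi)$; $V(\phi)=V^+(\phi)\cup V^-(\phi)$. A formula is $p^{\circ}$-free if $p\notin V^{\circ}(\phi)$, and $p$-free if $p\notin V(\phi)$. ULIP: for every formula $\phi$, atom $p$ and $\circ\in\{+,-\}$ there are $p^{\circ}$-free formulas $\exists^{\circ}p\,\phi$, $\forall^{\circ}p\,\phi$ with $V^{\dagger}(\exists^{\circ}p\,\phi)\subseteq V^{\dagger}(\phi)$ and $V^{\dagger}(\forall^{\circ}p\,\phi)\subseteq V^{\dagger}(\phi)$ for all $\dagger\in\{+,-\}$, such that $L\vdash\phi\to\exists^{\circ}p\,\phi$; for every $p^{\circ}$-free $\psi$, $L\vdash\phi\to\psi$ implies $L\vdash\exists^{\circ}p\,\phi\to\psi$;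 $L\vdash\forall^{\circ}p\,\phi\to\phi$; for every $p^{\circ}$-free $\psi$, $L\vdash\psi\to\phi$ implies $L\vdash\psi\to\forall^{\circ}p\,\phi$. UIP: for every $\phi$ and atom $p$ there are $p$-free formulas $\exists p\,\phi,\forall p\,\phi$ with $V(\exists p\,\phi)\subseteq V(\phi)$, $V(\forall p\,\phi)\subseteq V(\phi)$, such that $L\vdash\phi\to\exists p\,\phi$; for every $p$-free $\psi$, $L\vdash\phi\to\psi$ implies $L\vdash\exists p\,\phi\to\psi$; $L\vdash\forall p\,\phi\to\phi$; for every $p$-free $\psi$, $L\vdash\psi\to\phi$ implies $L\vdash\psi\to\forall p\,\phi$. LIP: whenever $L\vdash\phi\to\psi$ there is $\theta$ with $V^{\dagger}(\theta)\subseteq V^{\dagger}(\phi)\cap V^{\dagger}(\psi)$ for all $\dagger\in\{+,-\}$, $L\vdash\phi\to\theta$ and $L\vdash\theta\to\psi$. -}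

module Defs where

open import Data.Nat using (ℕ)
open import Data.Empty using (⊥)
open import Data.Product using (Σ; _×_)
open import Data.Sum using (_⊎_)
open import Relation.Nullary using (¬_)
open import Relation.Binary.PropositionalEquality using (_≡_)

data Formula : Set where
  atom : ℕ → Formula
  ⊥'   : Formula
  _∧'_ : Formula → Formula → Formula
  _∨'_ : Formula → Formula → Formula
  _⇒_  : Formula → Formula → Formula
  □_   : Formula → Formula

infixr 6 _∧'_
infixr 5 _∨'_
infixr 4 _⇒_

⊤' : Formula
⊤' = ⊥' ⇒ ⊥'

subst : (ℕ → Formula) → Formula → Formula
subst σ (atom p) = σ p
subst σ ⊥' = ⊥'
subst σ (φ ∧' ψ) = subst σ φ ∧' subst σ ψ
subst σ (φ ∨' ψ) = subst σ φ ∨' subst σ ψ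
subst σ (φ ⇒ ψ) = subst σ φ ⇒ subst σ ψ
subst σ (□ φ) = □ subst σ φ

-- Intuitionistic propositional logic (Hilbert system) over the full language;
-- its theorems are the intuitionistic propositional tautologies
-- (including their instances with □-formulas).
data IPC : Formula → Set where
  ax-K   : ∀ φ ψ → IPC (φ ⇒ ψ ⇒ φ)
  ax-S   : ∀ φ ψ χ → IPC ((φ ⇒ ψ ⇒ χ) ⇒ (φ ⇒ ψ) ⇒ φ ⇒ χ)
  ax-∧₁  : ∀ φ ψ → IPC (φ ∧' ψ ⇒ φ)
  ax-∧₂  : ∀ φ ψ → IPC (φ ∧' ψ ⇒ ψ)
  ax-∧I  : ∀ φ ψ → IPC (φ ⇒ ψ ⇒ φ ∧' ψ)
  ax-∨₁  : ∀ φ ψ → IPC (φ ⇒ φ ∨' ψ)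
  ax-∨₂  : ∀ φ ψ → IPC (ψ ⇒ φ ∨' ψ)
  ax-∨E  : ∀ φ ψ χ → IPC ((φ ⇒ χ) ⇒ (ψ ⇒ χ) ⇒ φ ∨' ψ ⇒ χ)
  ax-⊥   : ∀ φ → IPC (⊥' ⇒ φ)
  mp     : ∀ {φ ψ} → IPC (φ ⇒ ψ) → IPC φ → IPC ψ

-- A logic: a set of formulas (given as a predicate; L φ means L ⊢ φ)
-- containing IPC, closed under substitution and modus ponens.
record IsLogic (L : Formula → Set) : Set where
  field
    ipc   : ∀ {φ} → IPC φ → L φ
    sub   : ∀ (σ : ℕ → Formula) {φ} → L φ → L (subst σ φ)
    modus : ∀ {φ ψ} → L (φ ⇒ ψ) → L φ → L ψ

data Pol : Set where
  + - : Pol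

flip : Pol → Pol
flip + = -
flip - = +

Occ : Pol → Formula → ℕ → Set
Occ + (atom q) p = p ≡ q
Occ - (atom q) p = ⊥
Occ s ⊥' p = ⊥
Occ s (φ ∧' ψ) p = Occ s φ p ⊎ Occ s ψ p
Occ s (φ ∨' ψ) p = Occ s φ p ⊎ Occ s ψ p
Occ s (φ ⇒ ψ) p = Occ (flip s) φ p ⊎ Occ s ψ p
Occ s (□ φ) p = Occ s φ p

OccAny : Formula → ℕ → Set
OccAny φ p = Occ + φ p ⊎ Occ - φ p

Free : Pol → ℕ → Formula → Set
Free s p φ = ¬ Occ s φ p

FreeAll : ℕ → Formula → Set
FreeAll p φ = ¬ OccAny φ p

PolSub : Formula → Formula → Set
PolSub θ φ = ∀ (t : Pol) (q : ℕ) → Occ t θ q → Occ t φ q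

VarSub : Formula → Formula → Set
VarSub θ φ = ∀ (q : ℕ) → OccAny θ q → OccAny φ q

record ULIPWitness (L : Formula → Set) (φ : Formula) (p : ℕ) (s : Pol) : Set where
  field
    ∃φ ∀φ      : Formula
    ∃-free     : Free s p ∃φ
    ∀-free     : Free s p ∀φ
    ∃-vars     : PolSub ∃φ φ
    ∀-vars     : PolSub ∀φ φ
    ∃-intro    : L (φ ⇒ ∃φ)
    ∃-univ     : ∀ ψ → Free s p ψ → L (φ ⇒ ψ) → L (∃φ ⇒ ψ)
    ∀-elim     : L (∀φ ⇒ φ)
    ∀-univ     : ∀ ψ → Free s p ψ → L (ψ ⇒ φ) → L (ψ ⇒ ∀φ)

ULIP : (Formula → Set) → Set
ULIP L = ∀ (φ : Formula) (p : ℕ) (s : Pol) → ULIPWitness L φ p s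

record UIPWitness (L : Formula → Set) (φ : Formula) (p : ℕ) : Set where
  field
    ∃φ ∀φ      : Formula
    ∃-free     : FreeAll p ∃φ
    ∀-free     : FreeAll p ∀φ
    ∃-vars     : VarSub ∃φ φ
    ∀-vars     : VarSub ∀φ φ
    ∃-intro    : L (φ ⇒ ∃φ)
    ∃-univ     : ∀ ψ → FreeAll p ψ → L (φ ⇒ ψ) → L (∃φ ⇒ ψ)
    ∀-elim     : L (∀φ ⇒ φ)
    ∀-univ     : ∀ ψ → FreeAll p ψ → L (ψ ⇒ φ) → L (ψ ⇒ ∀φ)

UIP : (Formula → Set) → Set
UIP L = ∀ (φ : Formula) (p : ℕ) → UIPWitness L φ p

LIP : (Formula → Set) → Set
LIP L = ∀ (φ ψ : Formula) → L (φ ⇒ ψ) →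
  Σ Formula (λ θ → (∀ (t : Pol) (q : ℕ) → Occ t θ q → Occ t φ q × Occ t ψ q)
                   × L (φ ⇒ θ) × L (θ ⇒ ψ))

-- A uniform interpolant for both polarities at once is obtained by stacking
-- the two polarised ones: ∃p φ := ∃⁻p ∃⁺p φ and ∀p φ := ∀⁻p ∀⁺p φ.
-- For Lyndon interpolation of φ → ψ, eliminate from φ, one literal at a
-- time, every q^s that occurs in φ but not in V^s(ψ), replacing the current
-- formula χ by ∃ˢq χ. Each step keeps the implication to ψ because ψ is
-- q^s-free, and only ever shrinks the polarised variable sets, so the final
-- formula uses only literals common to φ and ψ.
module Submission where

open import Defs
open import Data.Product using (_×_; _,_)
open import Data.Sum using (_⊎_; inj₁; inj₂; [_,_]′)
import Data.Sum as Sum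
open import Data.Nat using (ℕ; _≟_)
open import Data.Empty using (⊥; ⊥-elim)
open import Data.List using (List; []; _∷_; _++_)
open import Data.List.Relation.Unary.Any using (here; there)
open import Data.List.Relation.Unary.Any.Properties using (++⁺ˡ; ++⁺ʳ)
open import Data.List.Membership.Propositional using (_∈_)
open import Relation.Nullary using (Dec; yes; no)
open import Relation.Nullary.Decidable using (_⊎-dec_)
open import Relation.Binary.PropositionalEquality using (_≡_; refl)

occ? : ∀ s φ p → Dec (Occ s φ p)
occ? + (atom q) p = p ≟ q
occ? - (atom q) p = no λ ()
occ? + ⊥'       p = no λ ()
occ? - ⊥'       p = no λ ()
occ? + (φ ∧' ψ) p = occ? + φ p ⊎-dec occ? + ψ p
occ? - (φ ∧' ψ) p = occ? - φ p ⊎-dec occ? - ψ p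
occ? + (φ ∨' ψ) p = occ? + φ p ⊎-dec occ? + ψ p
occ? - (φ ∨' ψ) p = occ? - φ p ⊎-dec occ? - ψ p
occ? + (φ ⇒ ψ)  p = occ? - φ p ⊎-dec occ? + ψ p
occ? - (φ ⇒ ψ)  p = occ? + φ p ⊎-dec occ? - ψ p
occ? + (□ φ)    p = occ? + φ p
occ? - (□ φ)    p = occ? - φ p

atoms : Formula → List ℕ
atoms (atom q) = q ∷ []
atoms ⊥'       = []
atoms (φ ∧' ψ) = atoms φ ++ atoms ψ
atoms (φ ∨' ψ) = atoms φ ++ atoms ψ
atoms (φ ⇒ ψ)  = atoms φ ++ atoms ψ
atoms (□ φ)    = atoms φ

occ⇒∈atoms : ∀ s φ {q} → Occ s φ q → q ∈ atoms φ
occ⇒∈atoms + (atom x) refl     = here refl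
occ⇒∈atoms + (φ ∧' ψ) (inj₁ o) = ++⁺ˡ (occ⇒∈atoms + φ o)
occ⇒∈atoms + (φ ∧' ψ) (inj₂ o) = ++⁺ʳ (atoms φ) (occ⇒∈atoms + ψ o)
occ⇒∈atoms + (φ ∨' ψ) (inj₁ o) = ++⁺ˡ (occ⇒∈atoms + φ o)
occ⇒∈atoms + (φ ∨' ψ) (inj₂ o) = ++⁺ʳ (atoms φ) (occ⇒∈atoms + ψ o)
occ⇒∈atoms + (φ ⇒ ψ)  (inj₁ o) = ++⁺ˡ (occ⇒∈atoms - φ o)
occ⇒∈atoms + (φ ⇒ ψ)  (inj₂ o) = ++⁺ʳ (atoms φ) (occ⇒∈atoms + ψ o)
occ⇒∈atoms + (□ φ)    o        = occ⇒∈atoms + φ o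
occ⇒∈atoms - (φ ∧' ψ) (inj₁ o) = ++⁺ˡ (occ⇒∈atoms - φ o)
occ⇒∈atoms - (φ ∧' ψ) (inj₂ o) = ++⁺ʳ (atoms φ) (occ⇒∈atoms - ψ o)
occ⇒∈atoms - (φ ∨' ψ) (inj₁ o) = ++⁺ˡ (occ⇒∈atoms - φ o)
occ⇒∈atoms - (φ ∨' ψ) (inj₂ o) = ++⁺ʳ (atoms φ) (occ⇒∈atoms - ψ o)
occ⇒∈atoms - (φ ⇒ ψ)  (inj₁ o) = ++⁺ˡ (occ⇒∈atoms + φ o)
occ⇒∈atoms - (φ ⇒ ψ)  (inj₂ o) = ++⁺ʳ (atoms φ) (occ⇒∈atoms - ψ o)
occ⇒∈atoms - (□ φ)    o        = occ⇒∈atoms - φ o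

polSub-refl : ∀ {φ} → PolSub φ φ
polSub-refl _ _ o = o

polSub-trans : ∀ {θ χ φ} → PolSub θ χ → PolSub χ φ → PolSub θ φ
polSub-trans θ⊆χ χ⊆φ t q o = χ⊆φ t q (θ⊆χ t q o)

polSub⇒varSub : ∀ {θ φ} → PolSub θ φ → VarSub θ φ
polSub⇒varSub θ⊆φ q = Sum.map (θ⊆φ + q) (θ⊆φ - q)

freeAll⇒free : ∀ s p φ → FreeAll p φ → Free s p φ
freeAll⇒free + _ _ p∉φ o = p∉φ (inj₁ o)
freeAll⇒free - _ _ p∉φ o = p∉φ (inj₂ o)

module _ {L : Formula → Set} (isL : IsLogic L) where
  open IsLogic isL

  ⇒-refl : ∀ {φ} → L (φ ⇒ φ)
  ⇒-refl {φ} = ipc (mp (mp (ax-S φ (φ ⇒ φ) φ) (ax-K φ (φ ⇒ φ))) (ax-K φ φ))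

  ⇒-trans : ∀ {φ ψ χ} → L (φ ⇒ ψ) → L (ψ ⇒ χ) → L (φ ⇒ χ)
  ⇒-trans {φ} {ψ} {χ} φ⇒ψ ψ⇒χ =
    modus (modus (ipc (ax-S φ ψ χ)) (modus (ipc (ax-K (ψ ⇒ χ) φ)) ψ⇒χ)) φ⇒ψ

  module _ (ulip : ULIP L) where

    ulip⇒uip : UIP L
    ulip⇒uip φ p = record
      { ∃φ      = ∃⁻.∃φ
      ; ∀φ      = ∀⁻.∀φ
      ; ∃-free  = [ (λ o → ⁺.∃-free (∃⁻.∃-vars + p o)) , ∃⁻.∃-free ]′
      ; ∀-free  = [ (λ o → ⁺.∀-free (∀⁻.∀-vars + p o)) , ∀⁻.∀-free ]′
      ; ∃-vars  = polSub⇒varSub (polSub-trans ∃⁻.∃-vars ⁺.∃-vars)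
      ; ∀-vars  = polSub⇒varSub (polSub-trans ∀⁻.∀-vars ⁺.∀-vars)
      ; ∃-intro = ⇒-trans ⁺.∃-intro ∃⁻.∃-intro
      ; ∃-univ  = λ ψ p∉ψ φ⇒ψ →
          ∃⁻.∃-univ ψ (freeAll⇒free - p ψ p∉ψ) (⁺.∃-univ ψ (freeAll⇒free + p ψ p∉ψ) φ⇒ψ)
      ; ∀-elim  = ⇒-trans ∀⁻.∀-elim ⁺.∀-elim
      ; ∀-univ  = λ ψ p∉ψ ψ⇒φ →
          ∀⁻.∀-univ ψ (freeAll⇒free - p ψ p∉ψ) (⁺.∀-univ ψ (freeAll⇒free + p ψ p∉ψ) ψ⇒φ)
      }
      where
      module ⁺  = ULIPWitness (ulip φ p +)
      module ∃⁻ = ULIPWitness (ulip ⁺.∃φ p -)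
      module ∀⁻ = ULIPWitness (ulip ⁺.∀φ p -)

    -- θ interpolates between χ and ψ as far as the literals in P are concerned.
    record Narrowing (χ ψ : Formula) (P : Pol → ℕ → Set) : Set where
      field
        θ        : Formula
        θ-vars   : PolSub θ χ
        χ⇒θ      : L (χ ⇒ θ)
        θ⇒ψ      : L (θ ⇒ ψ)
        θ-agrees : ∀ t q → P t q → Occ t θ q → Occ t ψ q

    narrow-nothing : ∀ {χ ψ} → L (χ ⇒ ψ) → Narrowing χ ψ (λ _ _ → ⊥)
    narrow-nothing {χ} χ⇒ψ = record
      { θ = χ ; θ-vars = polSub-refl ; χ⇒θ = ⇒-refl ; θ⇒ψ = χ⇒ψ ; θ-agrees = λ _ _ () }

    narrow-literal : ∀ {χ ψ} s q → L (χ ⇒ ψ) → Narrowing χ ψ (λ t x → t ≡ s × x ≡ q)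
    narrow-literal {χ} {ψ} s q χ⇒ψ with occ? s ψ q
    ... | yes q∈ψ = record
      { θ = χ ; θ-vars = polSub-refl ; χ⇒θ = ⇒-refl ; θ⇒ψ = χ⇒ψ
      ; θ-agrees = λ { _ _ (refl , refl) _ → q∈ψ } }
    ... | no q∉ψ = record
      { θ = ∃φ ; θ-vars = ∃-vars ; χ⇒θ = ∃-intro ; θ⇒ψ = ∃-univ ψ q∉ψ χ⇒ψ
      ; θ-agrees = λ { _ _ (refl , refl) o → ⊥-elim (∃-free o) } }
      where open ULIPWitness (ulip χ q s)

    narrow-then : ∀ {χ ψ P Q} (n : Narrowing χ ψ P) → Narrowing (Narrowing.θ n) ψ Q →
                  Narrowing χ ψ (λ t q → P t q ⊎ Q t q)
    narrow-then n m = record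
      { θ        = M.θ
      ; θ-vars   = polSub-trans M.θ-vars N.θ-vars
      ; χ⇒θ      = ⇒-trans N.χ⇒θ M.χ⇒θ
      ; θ⇒ψ      = M.θ⇒ψ
      ; θ-agrees = λ t q → [ (λ p o → N.θ-agrees t q p (M.θ-vars t q o)) , M.θ-agrees t q ]′
      }
      where
      module N = Narrowing n
      module M = Narrowing m

    narrow-weaken : ∀ {χ ψ P Q} → (∀ t q → Q t q → P t q) → Narrowing χ ψ P → Narrowing χ ψ Q
    narrow-weaken Q⊆P n = record
      { Narrowing n
      ; θ-agrees = λ t q Qtq → Narrowing.θ-agrees n t q (Q⊆P t q Qtq) }

    narrow-atoms : ∀ {χ ψ} qs → L (χ ⇒ ψ) → Narrowing χ ψ (λ _ q → q ∈ qs)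
    narrow-atoms []       χ⇒ψ = narrow-weaken (λ _ _ ()) (narrow-nothing χ⇒ψ)
    narrow-atoms (q ∷ qs) χ⇒ψ = narrow-weaken split
      (narrow-then pos (narrow-then neg (narrow-atoms qs (Narrowing.θ⇒ψ neg))))
      where
      pos = narrow-literal + q χ⇒ψ
      neg = narrow-literal - q (Narrowing.θ⇒ψ pos)
      split : ∀ t x → x ∈ q ∷ qs → (t ≡ + × x ≡ q) ⊎ ((t ≡ - × x ≡ q) ⊎ x ∈ qs)
      split + _ (here x≡q)  = inj₁ (refl , x≡q)
      split - _ (here x≡q)  = inj₂ (inj₁ (refl , x≡q))
      split _ _ (there x∈qs) = inj₂ (inj₂ x∈qs)

    ulip⇒lip : LIP L
    ulip⇒lip φ ψ φ⇒ψ = θ , shared , χ⇒θ , θ⇒ψ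
      where
      open Narrowing (narrow-atoms (atoms φ) φ⇒ψ)
      shared : ∀ t q → Occ t θ q → Occ t φ q × Occ t ψ q
      shared t q o = θ-vars t q o , θ-agrees t q (occ⇒∈atoms t φ (θ-vars t q o)) o

theorem2p5 : (L : Formula → Set) → IsLogic L → ULIP L → LIP L × UIP L
theorem2p5 L isL ulip = ulip⇒lip isL ulip , ulip⇒uip isL ulip
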